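{- Let $k,n>0$, let $\alpha,\alpha'<\omega^{\omega^\omega}$ be ordinals in Cantor normal form, and let $h$ be a smooth function. If $\alpha$ is $k$-lean and $\alpha'\in\partial_n\alpha$, then for all $x\geq kn$, $h_{\alpha'}(x)\leq h_{P_{kn}(\alpha)}(x)$.
   Context: $h:\mathbb{N}\to\mathbb{N}$ is smooth if $h(x+1)\geq h(x)+1\geq x+2$ for all $x$. An ordinal in CNF is $k$-lean if in strict form $\omega^{\beta_1}\cdot c_1+\cdots+\omega^{\beta_m}\cdot c_m$ ($\beta_1>\cdots>\beta_m$, $c_i>0$) all $c_i\leq k$ and all $\beta_i$ are $k$-lean. For $n>0$: $D_n(\omega^{\omega^p})=n-1$ if $p=0$, $\omega^{\omega^{p-1}\cdot(n-1)}\cdot(n-1)$ if $p>0$; $D_n(\omega^{\omega^{p_1}+\cdots+\omega^{p_k}})=\bigoplus_{j}(D_n(\omega^{\omega^{p_j}})\otimes\bigotimes_{\ell\neq j}\omega^{\omega^{p_\ell}})$ with natural sum $\oplus$ and product $\otimes$; $\partial_n(\sum_{i=1}^m\omega^{\beta_i})=\{D_n(\omega^{\beta_i})\oplus\bigoplus_{\ell\neq i}\omega^{\beta_\ell}\}_i$. Fundamental sequences: $(\gamma+\omega^{\beta+1})_x=\gamma+\omega^\beta\cdot(x+1)$, $(\gamma+\omega^\lambda)_x=\gamma+\omega^{\lambda_x}$. Predecessor (for $\alpha\neq0$): $P_x(\beta+1)=\beta$, $P_x(\lambda)=P_x(\lambda_x)$. Length hierarchy: $h_0(x)=0$, $h_{\beta+1}(x)=1+h_\beta(h(x))$,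 $h_\lambda(x)=h_{\lambda_x}(x)$. -}

module Defs where

open import Data.Nat using (ℕ; zero; suc; _≤_; _∸_; _≤ᵇ_; _≡ᵇ_)
open import Data.Bool using (Bool; true; false; if_then_else_; T; _∧_; _∨_)
open import Data.List using (List; []; _∷_; _++_; [_]; replicate; map; foldr; length; lookup; removeAt; allFin)
open import Data.List.Relation.Unary.All using (All)
open import Data.List.Relation.Unary.Linked using (Linked)
open import Data.Fin using (Fin)
open import Data.Product using (_×_; ∃)
open import Relation.Binary.PropositionalEquality using (_≡_)
import Data.Nat as N

-- Ordinals below ω^(ω^ω) in (non-strict) Cantor normal form.
--
-- An exponent  β = ω^{p₁} + ⋯ + ω^{pₖ}  (β < ω^ω, p₁ ≥ ⋯ ≥ pₖ) is the list
-- [p₁, …, pₖ] of naturals.  An ordinal α = ω^{β₁} + ⋯ + ω^{βₘ}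
-- (β₁ ≥ ⋯ ≥ βₘ) is the list [β₁, …, βₘ].  Coefficients of the strict
-- form are multiplicities.  E.g. ω^0 = 1 is [ [] ], and 0 is [].

Exp : Set
Exp = List ℕ

Ord : Set
Ord = List Exp

-- Ordinal order on exponents (descending lists): lexicographic order.
_≤Eᵇ_ : Exp → Exp → Bool
[]      ≤Eᵇ _       = true
(_ ∷ _) ≤Eᵇ []      = false
(p ∷ e) ≤Eᵇ (q ∷ f) = if p ≡ᵇ q then e ≤Eᵇ f else (p ≤ᵇ q)

_≤E_ : Exp → Exp → Set
e ≤E f = T (e ≤Eᵇ f)

DescExp : Exp → Set
DescExp = Linked (λ p q → q ≤ p)

IsCNF : Ord → Set
IsCNF α = All DescExp α × Linked (λ e f → f ≤E e) α

-- Natural (Hessenberg) sum of exponents: merge of decreasing lists.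
_⊕E_ : Exp → Exp → Exp
[]      ⊕E f       = f
(p ∷ e) ⊕E []      = p ∷ e
(p ∷ e) ⊕E (q ∷ f) = if q ≤ᵇ p then p ∷ (e ⊕E (q ∷ f)) else q ∷ ((p ∷ e) ⊕E f)

_⊕_ : Ord → Ord → Ord
[]      ⊕ β       = β
(e ∷ α) ⊕ []      = e ∷ α
(e ∷ α) ⊕ (f ∷ β) = if f ≤Eᵇ e then e ∷ (α ⊕ (f ∷ β)) else f ∷ ((e ∷ α) ⊕ β)

⨁ : List Ord → Ord
⨁ = foldr _⊕_ []

_⊗_ : Ord → Ord → Ord
α ⊗ β = ⨁ (map (λ e → ⨁ (map (λ f → [ e ⊕E f ]) β)) α)

ω^ : Exp → Ord
ω^ β = [ β ]

-- D_n(ω^{ω^p})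
Dbase : ℕ → ℕ → Ord
Dbase n zero    = replicate (n ∸ 1) []                            -- n - 1
Dbase n (suc p) = replicate (n ∸ 1) (replicate (n ∸ 1) p)         -- ω^{ω^p·(n-1)}·(n-1)

-- D_n(ω^{ω^{p₁}+⋯+ω^{pₖ}}) = ⊕_j ( D_n(ω^{ω^{p_j}}) ⊗ ⊗_{ℓ≠j} ω^{ω^{p_ℓ}} )
-- (⊗_{ℓ≠j} ω^{ω^{p_ℓ}} = ω^{⊕_{ℓ≠j} ω^{p_ℓ}}, i.e. ω^ of β with the j-th term removed)
D : ℕ → Exp → Ord
D n β = ⨁ (map (λ j → Dbase n (lookup β j) ⊗ ω^ (removeAt β j)) (allFin (length β)))

-- α' ∈ ∂_n α  where α = Σᵢ ω^{βᵢ}:  α' = D_n(ω^{βᵢ}) ⊕ ⊕_{ℓ≠i} ω^{β_ℓ} for some i.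
_∈∂[_]_ : Ord → ℕ → Ord → Set
α' ∈∂[ n ] α = ∃ λ (i : Fin (length α)) → α' ≡ D n (lookup α i) ⊕ removeAt α i

countℕ : ℕ → Exp → ℕ
countℕ p []      = 0
countℕ p (q ∷ e) = if p ≡ᵇ q then suc (countℕ p e) else countℕ p e

_≡Eᵇ_ : Exp → Exp → Bool
e ≡Eᵇ f = (e ≤Eᵇ f) ∧ (f ≤Eᵇ e)

countE : Exp → Ord → ℕ
countE e []      = 0
countE e (f ∷ α) = if e ≡Eᵇ f then suc (countE e α) else countE e α

-- k-lean.  A natural p = ω^0·p is k-lean iff p ≤ k.
LeanExp : ℕ → Exp → Set
LeanExp k β = All (λ p → p ≤ k × countℕ p β ≤ k) β

Lean : ℕ → Ord → Set
Lean k α = All (λ e → LeanExp k e × countE e α ≤ k) α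

-- On exponents: (γ + ω^{p+1})_x = γ + ω^p·(x+1).
data FSExp (x : ℕ) : Exp → Exp → Set where
  fse : ∀ γ p → FSExp x (γ ++ [ suc p ]) (γ ++ replicate (suc x) p)

-- On ordinals: (γ + ω^{β+1})_x = γ + ω^β·(x+1);  (γ + ω^λ)_x = γ + ω^{λ_x}.
data FS (x : ℕ) : Ord → Ord → Set where
  fs-succ : ∀ γ β → FS x (γ ++ [ β ++ [ 0 ] ]) (γ ++ replicate (suc x) β)
  fs-lim  : ∀ γ {λ' λx} → FSExp x λ' λx → FS x (γ ++ [ λ' ]) (γ ++ [ λx ])

-- Predecessor P_x (graph):  P_x(β+1) = β,  P_x(λ) = P_x(λ_x).
data Pred (x : ℕ) : Ord → Ord → Set where
  pred-succ : ∀ γ → Pred x (γ ++ [ [] ]) γ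
  pred-lim  : ∀ {α αx β} → FS x α αx → Pred x αx β → Pred x α β

-- Length hierarchy (graph):  Len h α x v  means  h_α(x) = v.
data Len (h : ℕ → ℕ) : Ord → ℕ → ℕ → Set where
  len-zero : ∀ x → Len h [] x 0
  len-succ : ∀ {γ x v} → Len h γ (h x) v → Len h (γ ++ [ [] ]) x (suc v)
  len-lim  : ∀ {α αx x v} → FS x α αx → Len h αx x v → Len h α x v

Smooth : (ℕ → ℕ) → Set
Smooth h = ∀ x → suc (h x) ≤ h (suc x) × suc (suc x) ≤ suc (h x)

module Submission where

-- The proof has
-- three independent parts, developed in this order:
--   * Order theory of descending lists (generic in the entry order):
--     natural sum is merging, and replacing one entry by smaller ones
--     decreases a list.
--   * Fundamental sequences versus "slim" ordinals (CNF with all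
--     coefficients ≤ y, also inside exponents): a slim β < γ stays below
--     γ[y], hence below P_y(γ).  A descent relation β ⊑_y γ (β is reached
--     from γ by predecessor and y-th fundamental-sequence steps) is
--     monotone in y, and the length hierarchy is monotone along it; this
--     gives h_β(x) ≤ h_γ(y) for x ≤ y when β ⊑_y γ, or β < γ slim.
--   * Derivatives: every α' ∈ ∂ₙ α of a k-lean α is below α and kn-slim.
-- The corollary combines: α' ≤ P_{kn}(α) with α' kn-slim.

open import Defs
open import Data.Nat using (ℕ; zero; suc; _+_; _*_; _∸_; _≤_; _<_; s≤s; z≤n; _≤ᵇ_; _≡ᵇ_)
import Data.Nat.Properties
open Data.Nat.Properties
  using ( ≤-refl; ≤-reflexive; ≤-trans; <-irrefl; <-trans; <-≤-trans; <-cmp; <⇒≤; ≰⇒>; n≤1+n; m≤n⇒m≤1+n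
        ; m≤n⇒m<n∨m≡n; ≤-pred; ≤ᵇ⇒≤; ≤⇒≤ᵇ; ≡ᵇ⇒≡; ≡⇒≡ᵇ; +-identityʳ; +-suc; +-comm; +-mono-≤
        ; *-comm; *-suc; *-zeroʳ; *-identityʳ; *-monoʳ-≤; *-distribˡ-+; m≤m*n; m≤n*m; m≤n+m; m+[n∸m]≡n; 0≢1+n; 1+n≢n)
open import Data.Bool using (Bool; true; false; if_then_else_; T)
open import Data.Bool.Properties using (T-∧)
open import Data.Unit using (tt)
open import Data.Empty using (⊥; ⊥-elim)
open import Data.Fin using (Fin; zero; suc)
open import Data.Fin.Properties using (any?)
open import Data.List using (List; []; _∷_; _++_; [_]; replicate; map; length; lookup; removeAt; tabulate)
open import Data.List.Properties using (++-identityʳ; ++-conicalʳ; ++-assoc; ∷ʳ-injective; map-tabulate; map-replicate; tabulate-cong)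
open import Data.List.Membership.Propositional using (_∈_)
open import Data.List.Membership.Propositional.Properties using (∈-lookup)
open import Data.List.Relation.Unary.Any using (here; there)
open import Data.List.Relation.Unary.All using (All; []; _∷_)
import Data.List.Relation.Unary.All as All
open import Data.List.Relation.Unary.All.Properties using (++⁻ʳ; replicate⁺; tabulate⁺)
open import Data.List.Relation.Unary.Linked using (Linked; []; [-]; _∷_)
import Data.List.Relation.Unary.Linked as Linked
open import Data.List.Relation.Unary.Linked.Properties using (Linked⇒All)
open import Data.List.Relation.Binary.Lex.Strict using (Lex-<; base; halt; this; next; xs≮[]; <-irreflexive; <-transitive)
open import Data.List.Relation.Binary.Pointwise using (≡⇒Pointwise-≡)
open import Data.Nat.ListAction using (sum)
open import Data.Product using (_×_; _,_; proj₁; proj₂; ∃; ∃₂)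
open import Data.Sum using (_⊎_; inj₁; inj₂)
open import Function.Bundles using (Equivalence)
open import Relation.Nullary using (¬_; yes; no)
open import Relation.Nullary.Decidable using (T?)
open import Relation.Binary using (tri<; tri≈; tri>)
open import Relation.Binary.PropositionalEquality
  using (_≡_; refl; sym; trans; cong; subst; cong₂; resp₂; isEquivalence; module ≡-Reasoning)

-- Boolean case analysis.  Merge-style recursions case on a boolean by
-- if-cases rather than `with`, which would hide their structural descent
-- from the termination checker.
if-cases : ∀ {X : Set} (Q : X → Set) b {u v : X} →
           (b ≡ true → Q u) → (b ≡ false → Q v) → Q (if b then u else v)
if-cases Q true  t _ = t refl
if-cases Q false _ f = f refl

T-from-≡ : ∀ {b} → b ≡ true → T b
T-from-≡ refl = tt

¬T-from-≡ : ∀ {b} → b ≡ false → ¬ T b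
¬T-from-≡ refl ()

if-true : ∀ {X : Set} b {x y : X} → T b → (if b then x else y) ≡ x
if-true true _ = refl

if-false : ∀ {X : Set} b {x y : X} → ¬ T b → (if b then x else y) ≡ y
if-false true  ¬t = ⊥-elim (¬t tt)
if-false false _  = refl

module DescendingLists
  {A : Set} (_≺_ : A → A → Set) (_≤ᵇ_ _≟ᵇ_ : A → A → Bool)
  (≤ᵇ-sound : ∀ {a b} → T (a ≤ᵇ b) → a ≺ b ⊎ a ≡ b)
  (≤ᵇ-total : ∀ {a b} → ¬ T (a ≤ᵇ b) → b ≺ a)
  (≺-irrefl : ∀ {a} → ¬ a ≺ a)
  (≺-trans : ∀ {a b c} → a ≺ b → b ≺ c → a ≺ c)
  (≟ᵇ-sound : ∀ {a b} → T (a ≟ᵇ b) → a ≡ b)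
  (≟ᵇ-refl : ∀ a → T (a ≟ᵇ a))
  where

  ≤ᵇ-refl : ∀ a → T (a ≤ᵇ a)
  ≤ᵇ-refl a with T? (a ≤ᵇ a)
  ... | yes t = t
  ... | no ¬t = ⊥-elim (≺-irrefl (≤ᵇ-total ¬t))

  ≺⇒≤ᵇ : ∀ {a b} → a ≺ b → T (a ≤ᵇ b)
  ≺⇒≤ᵇ {a} {b} a≺b with T? (a ≤ᵇ b)
  ... | yes t = t
  ... | no ¬t = ⊥-elim (≺-irrefl (≺-trans a≺b (≤ᵇ-total ¬t)))

  ≺-≤ᵇ-trans : ∀ {a b c} → a ≺ b → T (b ≤ᵇ c) → a ≺ c
  ≺-≤ᵇ-trans a≺b b≤c with ≤ᵇ-sound b≤c
  ... | inj₁ b≺c = ≺-trans a≺b b≺c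
  ... | inj₂ refl = a≺b

  ≤ᵇ-trans : ∀ {a b c} → T (a ≤ᵇ b) → T (b ≤ᵇ c) → T (a ≤ᵇ c)
  ≤ᵇ-trans a≤b b≤c with ≤ᵇ-sound a≤b
  ... | inj₁ a≺b = ≺⇒≤ᵇ (≺-≤ᵇ-trans a≺b b≤c)
  ... | inj₂ refl = b≤c

  ≺⇒≰ᵇ : ∀ {a b} → a ≺ b → ¬ T (b ≤ᵇ a)
  ≺⇒≰ᵇ a≺b b≤a = ≺-irrefl (≺-≤ᵇ-trans a≺b b≤a)

  infix 4 _<ₗ_
  _<ₗ_ : List A → List A → Set
  _<ₗ_ = Lex-< _≡_ _≺_

  <ₗ-irrefl : ∀ {xs} → ¬ xs <ₗ xs
  <ₗ-irrefl = <-irreflexive (λ { refl → ≺-irrefl }) (≡⇒Pointwise-≡ refl)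

  <ₗ-trans : ∀ {xs ys zs} → xs <ₗ ys → ys <ₗ zs → xs <ₗ zs
  <ₗ-trans = <-transitive isEquivalence (resp₂ _≺_) ≺-trans

  <ₗ-extension : ∀ g {m M} → g <ₗ g ++ m ∷ M
  <ₗ-extension []      = halt
  <ₗ-extension (x ∷ g) = next refl (<ₗ-extension g)

  <ₗ-++ʳ : ∀ {xs ys} M → xs <ₗ ys → xs <ₗ ys ++ M
  <ₗ-++ʳ M halt        = halt
  <ₗ-++ʳ M (this x≺y)  = this x≺y
  <ₗ-++ʳ M (next eq r) = next eq (<ₗ-++ʳ M r)

  <ₗ-prefix : ∀ g {xs ys} → xs <ₗ ys → g ++ xs <ₗ g ++ ys
  <ₗ-prefix []      r = r
  <ₗ-prefix (x ∷ g) r = next refl (<ₗ-prefix g r)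

  <ₗ-snoc-inv : ∀ g {L xs} → xs <ₗ g ++ [ L ] →
                xs <ₗ g ⊎ xs ≡ g ⊎ ∃₂ λ e r → xs ≡ g ++ e ∷ r × e ≺ L
  <ₗ-snoc-inv []      halt                    = inj₂ (inj₁ refl)
  <ₗ-snoc-inv []      (this {xs = r} e≺L)    = inj₂ (inj₂ (_ , r , refl , e≺L))
  <ₗ-snoc-inv []      (next refl (base ()))
  <ₗ-snoc-inv (y ∷ g) halt                    = inj₁ halt
  <ₗ-snoc-inv (y ∷ g) (this x≺y)              = inj₁ (this x≺y)
  <ₗ-snoc-inv (y ∷ g) (next refl r) with <ₗ-snoc-inv g r
  ... | inj₁ lt                        = inj₁ (next refl lt)
  ... | inj₂ (inj₁ eq)                 = inj₂ (inj₁ (cong (y ∷_) eq))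
  ... | inj₂ (inj₂ (e , r' , eq , lt)) = inj₂ (inj₂ (e , r' , cong (y ∷_) eq , lt))

  <ₗ-snoc-replace : ∀ g {L m M xs} → xs <ₗ g ++ [ L ] →
                    (∀ e r → xs ≡ g ++ e ∷ r → e ≺ L → xs <ₗ g ++ m ∷ M) → xs <ₗ g ++ m ∷ M
  <ₗ-snoc-replace g r below-L with <ₗ-snoc-inv g r
  ... | inj₁ lt                        = <ₗ-++ʳ _ lt
  ... | inj₂ (inj₁ refl)               = <ₗ-extension g
  ... | inj₂ (inj₂ (e , r' , eq , e≺L)) = below-L e r' eq e≺L

  <ₗ-snoc-least : ∀ {z} → (∀ a → ¬ a ≺ z) → ∀ g {xs} → xs <ₗ g ++ [ z ] → xs ≡ g ⊎ xs <ₗ g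
  <ₗ-snoc-least least g r with <ₗ-snoc-inv g r
  ... | inj₁ lt                      = inj₂ lt
  ... | inj₂ (inj₁ eq)               = inj₁ eq
  ... | inj₂ (inj₂ (e , _ , _ , e≺z)) = ⊥-elim (least e e≺z)

  merge : List A → List A → List A
  merge []       ys       = ys
  merge (x ∷ xs) []       = x ∷ xs
  merge (x ∷ xs) (y ∷ ys) = if y ≤ᵇ x then x ∷ merge xs (y ∷ ys) else y ∷ merge (x ∷ xs) ys

  count : A → List A → ℕ
  count c []       = 0
  count c (x ∷ xs) = if c ≟ᵇ x then suc (count c xs) else count c xs

  Sorted : List A → Set
  Sorted = Linked (λ a b → T (b ≤ᵇ a))

  sorted-tail : ∀ {x xs} → Sorted (x ∷ xs) → Sorted xs
  sorted-tail [-]     = []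
  sorted-tail (_ ∷ s) = s

  sorted-++ʳ : ∀ g {xs} → Sorted (g ++ xs) → Sorted xs
  sorted-++ʳ []      s = s
  sorted-++ʳ (x ∷ g) s = sorted-++ʳ g (sorted-tail s)

  sorted-≤-head : ∀ {x xs} → Sorted (x ∷ xs) → All (λ y → T (y ≤ᵇ x)) (x ∷ xs)
  sorted-≤-head s = Linked⇒All (λ x≤y y≤z → ≤ᵇ-trans y≤z x≤y) (≤ᵇ-refl _) s

  replicate-sorted : ∀ m x → Sorted (replicate m x)
  replicate-sorted zero          x = []
  replicate-sorted (suc zero)    x = [-]
  replicate-sorted (suc (suc m)) x = ≤ᵇ-refl x ∷ replicate-sorted (suc m) x

  merge-All : ∀ {P : A → Set} xs ys → All P xs → All P ys → All P (merge xs ys)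
  merge-All []       ys       _          pys        = pys
  merge-All (x ∷ xs) []       pxs        _          = pxs
  merge-All {P} (x ∷ xs) (y ∷ ys) (px ∷ pxs) (py ∷ pys) = if-cases (All P) (y ≤ᵇ x)
    (λ _ → px ∷ merge-All xs (y ∷ ys) pxs (py ∷ pys))
    (λ _ → py ∷ merge-All (x ∷ xs) ys (px ∷ pxs) pys)

  merge-sorted-under : ∀ z xs ys → Sorted (z ∷ xs) → Sorted (z ∷ ys) → Sorted (z ∷ merge xs ys)
  merge-sorted-under z []       ys       _          sy         = sy
  merge-sorted-under z (x ∷ xs) []       sx         _          = sx
  merge-sorted-under z (x ∷ xs) (y ∷ ys) (x≤z ∷ sx) (y≤z ∷ sy) = if-cases (λ m → Sorted (z ∷ m)) (y ≤ᵇ x)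
    (λ y≤x → x≤z ∷ merge-sorted-under x xs (y ∷ ys) sx (T-from-≡ y≤x ∷ sy))
    (λ y≰x → y≤z ∷ merge-sorted-under y (x ∷ xs) ys (≺⇒≤ᵇ (≤ᵇ-total (¬T-from-≡ y≰x)) ∷ sx) sy)

  merge-sorted : ∀ xs ys → Sorted xs → Sorted ys → Sorted (merge xs ys)
  merge-sorted []       ys       _  sy = sy
  merge-sorted (x ∷ xs) []       sx _  = sx
  merge-sorted (x ∷ xs) (y ∷ ys) sx sy = if-cases Sorted (y ≤ᵇ x)
    (λ y≤x → merge-sorted-under x xs (y ∷ ys) sx (T-from-≡ y≤x ∷ sy))
    (λ y≰x → merge-sorted-under y (x ∷ xs) ys (≺⇒≤ᵇ (≤ᵇ-total (¬T-from-≡ y≰x)) ∷ sx) sy)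

  count-∷ˡ : ∀ c x zs xs {n} → count c zs ≡ count c xs + n → count c (x ∷ zs) ≡ count c (x ∷ xs) + n
  count-∷ˡ c x _ _ eq with c ≟ᵇ x
  ... | true  = cong suc eq
  ... | false = eq

  count-∷ʳ : ∀ c y zs ys {m} → count c zs ≡ m + count c ys → count c (y ∷ zs) ≡ m + count c (y ∷ ys)
  count-∷ʳ c y _ _ {m} eq with c ≟ᵇ y
  ... | true  = trans (cong suc eq) (sym (+-suc m _))
  ... | false = eq

  merge-count : ∀ c xs ys → count c (merge xs ys) ≡ count c xs + count c ys
  merge-count c []       ys       = refl
  merge-count c (x ∷ xs) []       = sym (+-identityʳ _)
  merge-count c (x ∷ xs) (y ∷ ys) = if-cases (λ m → count c m ≡ count c (x ∷ xs) + count c (y ∷ ys)) (y ≤ᵇ x)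
    (λ _ → count-∷ˡ c x (merge xs (y ∷ ys)) xs (merge-count c xs (y ∷ ys)))
    (λ _ → count-∷ʳ c y (merge (x ∷ xs) ys) ys (merge-count c (x ∷ xs) ys))

  count-++ : ∀ c g xs → count c (g ++ xs) ≡ count c g + count c xs
  count-++ c []      xs = refl
  count-++ c (x ∷ g) xs = count-∷ˡ c x (g ++ xs) g (count-++ c g xs)

  count-++-≤ʳ : ∀ c g xs → count c xs ≤ count c (g ++ xs)
  count-++-≤ʳ c g xs = ≤-trans (m≤n+m _ (count c g)) (≤-reflexive (sym (count-++ c g xs)))

  count-replicate : ∀ c m x → count c (replicate m x) ≡ (if c ≟ᵇ x then m else 0)
  count-replicate c zero    x with c ≟ᵇ x
  ... | true  = refl
  ... | false = refl
  count-replicate c (suc m) x with c ≟ᵇ x in eq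
  ... | true  = cong suc (trans (count-replicate c m x) (cong (λ b → if b then m else 0) eq))
  ... | false = trans (count-replicate c m x) (cong (λ b → if b then m else 0) eq)

  count-replicate-≤ : ∀ c m x → count c (replicate m x) ≤ m
  count-replicate-≤ c zero    x = z≤n
  count-replicate-≤ c (suc m) x with c ≟ᵇ x
  ... | true  = s≤s (count-replicate-≤ c m x)
  ... | false = m≤n⇒m≤1+n (count-replicate-≤ c m x)

  count-zero-or-∈ : ∀ c xs → count c xs ≡ 0 ⊎ c ∈ xs
  count-zero-or-∈ c []       = inj₁ refl
  count-zero-or-∈ c (x ∷ xs) with c ≟ᵇ x in eq
  ... | true  = inj₂ (here (≟ᵇ-sound (T-from-≡ eq)))
  ... | false with count-zero-or-∈ c xs
  ...   | inj₁ zero-count = inj₁ zero-count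
  ...   | inj₂ c∈xs       = inj₂ (there c∈xs)

  count-below : ∀ {c} xs → All (_≺ c) xs → count c xs ≡ 0
  count-below {c} xs below with count-zero-or-∈ c xs
  ... | inj₁ zero-count = zero-count
  ... | inj₂ c∈xs       = ⊥-elim (≺-irrefl (All.lookup below c∈xs))

  count-bound : ∀ {k} xs → (∀ {c} → c ∈ xs → count c xs ≤ k) → ∀ c → count c xs ≤ k
  count-bound xs bound c with count-zero-or-∈ c xs
  ... | inj₁ zero-count = ≤-trans (≤-reflexive zero-count) z≤n
  ... | inj₂ c∈xs       = bound c∈xs

  count-as-sum : ∀ c xs → count c xs ≡ sum (tabulate (λ j → if c ≟ᵇ lookup xs j then 1 else 0))
  count-as-sum c []       = refl
  count-as-sum c (x ∷ xs) with c ≟ᵇ x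
  ... | true  = cong suc (count-as-sum c xs)
  ... | false = count-as-sum c xs

  removeAt-All : ∀ {P : A → Set} xs (i : Fin (length xs)) → All P xs → All P (removeAt xs i)
  removeAt-All (x ∷ xs) zero    (_  ∷ pxs) = pxs
  removeAt-All (x ∷ xs) (suc i) (px ∷ pxs) = px ∷ removeAt-All xs i pxs

  removeAt-sorted-under : ∀ z xs (i : Fin (length xs)) → Sorted (z ∷ xs) → Sorted (z ∷ removeAt xs i)
  removeAt-sorted-under z (x ∷ [])     zero    _              = [-]
  removeAt-sorted-under z (x ∷ y ∷ xs) zero    (x≤z ∷ y≤x ∷ s) = ≤ᵇ-trans y≤x x≤z ∷ s
  removeAt-sorted-under z (x ∷ xs)     (suc i) (x≤z ∷ s)       = x≤z ∷ removeAt-sorted-under x xs i s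

  removeAt-sorted : ∀ xs (i : Fin (length xs)) → Sorted xs → Sorted (removeAt xs i)
  removeAt-sorted (x ∷ xs) zero    s = sorted-tail s
  removeAt-sorted (x ∷ xs) (suc i) s = removeAt-sorted-under x xs i s

  removeAt-count : ∀ c xs (i : Fin (length xs)) →
    count c xs ≡ (if c ≟ᵇ lookup xs i then suc (count c (removeAt xs i)) else count c (removeAt xs i))
  removeAt-count c (x ∷ xs) zero    = refl
  removeAt-count c (x ∷ xs) (suc i) with c ≟ᵇ x | c ≟ᵇ lookup xs i | removeAt-count c xs i
  ... | true  | true  | eq = cong suc eq
  ... | true  | false | eq = cong suc eq
  ... | false | true  | eq = eq
  ... | false | false | eq = eq

  removeAt-count-≤ : ∀ c xs (i : Fin (length xs)) → count c (removeAt xs i) ≤ count c xs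
  removeAt-count-≤ c xs i with c ≟ᵇ lookup xs i | removeAt-count c xs i
  ... | true  | eq = ≤-trans (n≤1+n _) (≤-reflexive (sym eq))
  ... | false | eq = ≤-reflexive (sym eq)

  removeAt-count-same : ∀ xs (i : Fin (length xs)) → count (lookup xs i) xs ≡ suc (count (lookup xs i) (removeAt xs i))
  removeAt-count-same xs i = trans (removeAt-count _ xs i) (if-true _ (≟ᵇ-refl (lookup xs i)))

  removeAt-count-other : ∀ c xs (i : Fin (length xs)) → ¬ c ≡ lookup xs i → count c (removeAt xs i) ≡ count c xs
  removeAt-count-other c xs i c≢ = sym (trans (removeAt-count c xs i) (if-false _ (λ t → c≢ (≟ᵇ-sound t))))

  merge-below-head : ∀ s xs ts → Sorted (s ∷ xs) → All (_≺ s) ts → merge ts xs <ₗ s ∷ xs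
  merge-below-head s []       []       _         _          = halt
  merge-below-head s []       (t ∷ ts) _         (t≺s ∷ _)  = this t≺s
  merge-below-head s (x ∷ xs) []       (x≤s ∷ sx) _         with ≤ᵇ-sound x≤s
  ... | inj₁ x≺s  = this x≺s
  ... | inj₂ refl = next refl (merge-below-head x xs [] sx [])
  merge-below-head s (x ∷ xs) (t ∷ ts) (x≤s ∷ sx) (t≺s ∷ ts≺s) with x ≤ᵇ t
  ... | true = this t≺s
  ... | false with ≤ᵇ-sound x≤s
  ...   | inj₁ x≺s  = this x≺s
  ...   | inj₂ refl = next refl (merge-below-head x xs (t ∷ ts) sx (t≺s ∷ ts≺s))

  merge-below : ∀ xs (i : Fin (length xs)) ts → Sorted xs → All (_≺ lookup xs i) ts →
                merge ts (removeAt xs i) <ₗ xs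
  merge-below (x ∷ xs) zero    ts       s ts≺ = merge-below-head x xs ts s ts≺
  merge-below (x ∷ xs) (suc i) []       s ts≺ = next refl (merge-below xs i [] (sorted-tail s) ts≺)
  merge-below (x ∷ xs) (suc i) (t ∷ ts) s ts≺@(t≺ ∷ _) with x ≤ᵇ t in eq
  ... | true  = ⊥-elim (≺⇒≰ᵇ t≺x (T-from-≡ eq))
    where
      t≺x : t ≺ x
      t≺x = ≺-≤ᵇ-trans t≺ (All.lookup (sorted-≤-head s) (there (∈-lookup i)))
  ... | false = next refl (merge-below xs i (t ∷ ts) (sorted-tail s) ts≺)

  below-replicate : ∀ b xs m → Sorted xs → All (λ x → T (x ≤ᵇ b)) xs → suc (count b xs) ≤ m →
                    xs <ₗ replicate m b
  below-replicate b []       (suc m) _ _           _ = halt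
  below-replicate b (x ∷ xs) (suc m) s (x≤b ∷ xs≤b) c with ≤ᵇ-sound x≤b
  ... | inj₁ x≺b  = this x≺b
  ... | inj₂ refl with x ≟ᵇ x in eq
  ...   | false = ⊥-elim (¬T-from-≡ eq (≟ᵇ-refl x))
  ...   | true  = next refl (below-replicate x xs m (sorted-tail s) xs≤b (≤-pred c))

≤ᵇ-sound-ℕ : ∀ {a b} → T (a ≤ᵇ b) → a < b ⊎ a ≡ b
≤ᵇ-sound-ℕ {a} {b} t = m≤n⇒m<n∨m≡n (≤ᵇ⇒≤ a b t)

≤ᵇ-total-ℕ : ∀ {a b} → ¬ T (a ≤ᵇ b) → b < a
≤ᵇ-total-ℕ ¬t = ≰⇒> (λ a≤b → ¬t (≤⇒≤ᵇ a≤b))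

≡ᵇ-refl-ℕ : ∀ a → T (a ≡ᵇ a)
≡ᵇ-refl-ℕ a = ≡⇒≡ᵇ a a refl

module E = DescendingLists _<_ _≤ᵇ_ _≡ᵇ_ ≤ᵇ-sound-ℕ ≤ᵇ-total-ℕ (<-irrefl refl) <-trans
                           (λ {a} {b} → ≡ᵇ⇒≡ a b) ≡ᵇ-refl-ℕ
open E using () renaming (_<ₗ_ to _<E_)

≤Eᵇ-sound : ∀ {e f} → T (e ≤Eᵇ f) → e <E f ⊎ e ≡ f
≤Eᵇ-sound {[]}    {[]}    _ = inj₂ refl
≤Eᵇ-sound {[]}    {q ∷ f} _ = inj₁ halt
≤Eᵇ-sound {p ∷ e} {q ∷ f} t with p ≡ᵇ q in eq
... | true with ≡ᵇ⇒≡ p q (T-from-≡ eq) | ≤Eᵇ-sound {e} {f} t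
...   | refl | inj₁ e<f  = inj₁ (next refl e<f)
...   | refl | inj₂ refl = inj₂ refl
≤Eᵇ-sound {p ∷ e} {q ∷ f} t | false with ≤ᵇ-sound-ℕ t
... | inj₁ p<q  = inj₁ (this p<q)
... | inj₂ refl = ⊥-elim (¬T-from-≡ eq (≡ᵇ-refl-ℕ p))

≤Eᵇ-total : ∀ {e f} → ¬ T (e ≤Eᵇ f) → f <E e
≤Eᵇ-total {[]}    ¬t = ⊥-elim (¬t tt)
≤Eᵇ-total {p ∷ e} {[]}    _  = halt
≤Eᵇ-total {p ∷ e} {q ∷ f} ¬t with p ≡ᵇ q in eq
... | true with ≡ᵇ⇒≡ p q (T-from-≡ eq)
...   | refl = next refl (≤Eᵇ-total ¬t)
≤Eᵇ-total {p ∷ e} {q ∷ f} ¬t | false = this (≤ᵇ-total-ℕ ¬t)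

≤Eᵇ-refl : ∀ e → T (e ≤Eᵇ e)
≤Eᵇ-refl e with T? (e ≤Eᵇ e)
... | yes t = t
... | no ¬t = ⊥-elim (E.<ₗ-irrefl {e} (≤Eᵇ-total ¬t))

≡Eᵇ-sound : ∀ {e f} → T (e ≡Eᵇ f) → e ≡ f
≡Eᵇ-sound {e} {f} t with Equivalence.to T-∧ t
... | e≤f , f≤e with ≤Eᵇ-sound {e} {f} e≤f | ≤Eᵇ-sound {f} {e} f≤e
...   | inj₂ e≡f | _         = e≡f
...   | inj₁ _   | inj₂ f≡e  = sym f≡e
...   | inj₁ e<f | inj₁ f<e  = ⊥-elim (E.<ₗ-irrefl (E.<ₗ-trans e<f f<e))

≡Eᵇ-refl : ∀ e → T (e ≡Eᵇ e)
≡Eᵇ-refl e = Equivalence.from T-∧ (≤Eᵇ-refl e , ≤Eᵇ-refl e)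

module O = DescendingLists _<E_ _≤Eᵇ_ _≡Eᵇ_ ≤Eᵇ-sound ≤Eᵇ-total E.<ₗ-irrefl E.<ₗ-trans ≡Eᵇ-sound ≡Eᵇ-refl
open O using () renaming (_<ₗ_ to _<O_)

⊕E-merge : ∀ e f → e ⊕E f ≡ E.merge e f
⊕E-merge []      f       = refl
⊕E-merge (p ∷ e) []      = refl
⊕E-merge (p ∷ e) (q ∷ f) =
  cong₂ (λ u v → if q ≤ᵇ p then p ∷ u else q ∷ v) (⊕E-merge e (q ∷ f)) (⊕E-merge (p ∷ e) f)

⊕-merge : ∀ α β → α ⊕ β ≡ O.merge α β
⊕-merge []      β       = refl
⊕-merge (e ∷ α) []      = refl
⊕-merge (e ∷ α) (f ∷ β) =
  cong₂ (λ u v → if f ≤Eᵇ e then e ∷ u else f ∷ v) (⊕-merge α (f ∷ β)) (⊕-merge (e ∷ α) β)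

countℕ-count : ∀ p e → countℕ p e ≡ E.count p e
countℕ-count p []      = refl
countℕ-count p (q ∷ e) with p ≡ᵇ q
... | true  = cong suc (countℕ-count p e)
... | false = countℕ-count p e

countE-count : ∀ e α → countE e α ≡ O.count e α
countE-count e []      = refl
countE-count e (f ∷ α) with e ≡Eᵇ f
... | true  = cong suc (countE-count e α)
... | false = countE-count e α

desc-sorted : ∀ {e} → DescExp e → E.Sorted e
desc-sorted = Linked.map ≤⇒≤ᵇ

sorted-desc : ∀ {e} → E.Sorted e → DescExp e
sorted-desc = Linked.map (λ {a} {b} → ≤ᵇ⇒≤ b a)

-- β is y-slim: a Cantor normal form in which no exponent occurs more than
-- y times, and no natural occurs more than y times inside an exponent.
-- (A k-lean ordinal is k-slim; slimness is what the fundamental sequences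
-- at level y respect.)
Slim : ℕ → Ord → Set
Slim y β = IsCNF β × (∀ e → countE e β ≤ y) × All (λ e → ∀ q → countℕ q e ≤ y) β

Slim-mono : ∀ {x y β} → x ≤ y → Slim x β → Slim y β
Slim-mono x≤y (cnf , bound , bound-exp) =
  cnf , (λ e → ≤-trans (bound e) x≤y) , All.map (λ b q → ≤-trans (b q) x≤y) bound-exp

below-exp-fundamental : ∀ c q y e → e <E c ++ [ suc q ] → DescExp e → countℕ q e ≤ y →
                        e <E c ++ replicate (suc y) q
below-exp-fundamental c q y e e< desc bound = E.<ₗ-snoc-replace c e< below
  where
    below : ∀ w r → e ≡ c ++ w ∷ r → w < suc q → e <E c ++ q ∷ replicate y q
    below w r refl (s≤s w≤q) with m≤n⇒m<n∨m≡n w≤q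
    ... | inj₁ w<q  = E.<ₗ-prefix c (this w<q)
    ... | inj₂ refl = E.<ₗ-prefix c (E.below-replicate w (w ∷ r) (suc y) sorted (E.sorted-≤-head sorted) (s≤s count≤y))
      where
        sorted : E.Sorted (w ∷ r)
        sorted = E.sorted-++ʳ c (desc-sorted desc)
        count≤y : E.count w (w ∷ r) ≤ y
        count≤y = ≤-trans (E.count-++-≤ʳ w c (w ∷ r)) (≤-trans (≤-reflexive (sym (countℕ-count w e))) bound)

below-fundamental : ∀ {y β γ γ[y]} → β <O γ → Slim y β → FS y γ γ[y] → β <O γ[y]
below-fundamental {y} {β} lt ((desc , sorted) , bound , bound-exp) (fs-succ g b) = O.<ₗ-snoc-replace g lt below
  where
    below : ∀ e r → β ≡ g ++ e ∷ r → e <E b ++ [ 0 ] → β <O g ++ b ∷ replicate y b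
    below e r refl e<b+1 with E.<ₗ-snoc-least (λ _ ()) b e<b+1
    ... | inj₂ e<b = O.<ₗ-prefix g (this e<b)
    ... | inj₁ refl = O.<ₗ-prefix g (O.below-replicate e (e ∷ r) (suc y) sorted′ (O.sorted-≤-head sorted′) (s≤s count≤y))
      where
        sorted′ : O.Sorted (e ∷ r)
        sorted′ = O.sorted-++ʳ g sorted
        count≤y : O.count e (e ∷ r) ≤ y
        count≤y = ≤-trans (O.count-++-≤ʳ e g (e ∷ r)) (≤-trans (≤-reflexive (sym (countE-count e β))) (bound e))
below-fundamental {y} {β} lt ((desc , _) , _ , bound-exp) (fs-lim g (fse c q)) = O.<ₗ-snoc-replace g lt below
  where
    below : ∀ e r → β ≡ g ++ e ∷ r → e <E c ++ [ suc q ] → β <O g ++ (c ++ replicate (suc y) q) ∷ []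
    below e r refl e<λ with ++⁻ʳ g desc | ++⁻ʳ g bound-exp
    ... | desc-e ∷ _ | bound-e ∷ _ = O.<ₗ-prefix g (this (below-exp-fundamental c q y e e<λ desc-e (bound-e q)))

below-pred : ∀ {y α p β} → Pred y α p → β <O α → Slim y β → β ≡ p ⊎ β <O p
below-pred (pred-succ γ)   lt _    = O.<ₗ-snoc-least (λ _ → xs≮[]) γ lt
below-pred (pred-lim fs p) lt slim = below-pred p (below-fundamental lt slim fs) slim

infix 4 _⊑⟨_⟩_
data _⊑⟨_⟩_ : Ord → ℕ → Ord → Set where
  ⊑-refl : ∀ {β y} → β ⊑⟨ y ⟩ β
  ⊑-succ : ∀ {β y γ} → β ⊑⟨ y ⟩ γ → β ⊑⟨ y ⟩ γ ++ [ [] ]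
  ⊑-lim  : ∀ {β y γ γ[y]} → FS y γ γ[y] → β ⊑⟨ y ⟩ γ[y] → β ⊑⟨ y ⟩ γ

⊑-trans : ∀ {y α β γ} → α ⊑⟨ y ⟩ β → β ⊑⟨ y ⟩ γ → α ⊑⟨ y ⟩ γ
⊑-trans p ⊑-refl       = p
⊑-trans p (⊑-succ q)   = ⊑-succ (⊑-trans p q)
⊑-trans p (⊑-lim fs q) = ⊑-lim fs (⊑-trans p q)

module ExpInduction (P : Exp → Set)
  (succ-step : ∀ c → P c → P (c ++ [ 0 ]))
  (lim-step  : ∀ c q → (∀ m → P (c ++ replicate m q)) → P (c ++ [ suc q ]))
  where

  append-one    : ∀ p c → P c → P (c ++ [ p ])
  append-copies : ∀ q m c → P c → P (c ++ replicate m q)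
  append-one zero    c pc = succ-step c pc
  append-one (suc q) c pc = lim-step c q (λ m → append-copies q m c pc)
  append-copies q zero    c pc = subst P (sym (++-identityʳ c)) pc
  append-copies q (suc m) c pc =
    subst P (++-assoc c [ q ] (replicate m q)) (append-copies q m (c ++ [ q ]) (append-one q c pc))

  append : ∀ e c → P c → P (c ++ e)
  append []      c pc = subst P (sym (++-identityʳ c)) pc
  append (p ∷ e) c pc = subst P (++-assoc c [ p ] e) (append e (c ++ [ p ]) (append-one p c pc))

⊑-copies : ∀ {y c} → (∀ δ → δ ⊑⟨ y ⟩ δ ++ [ c ]) → ∀ m δ → δ ⊑⟨ y ⟩ δ ++ replicate m c
⊑-copies         step zero    δ = subst (δ ⊑⟨ _ ⟩_) (sym (++-identityʳ δ)) ⊑-refl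
⊑-copies {c = c} step (suc m) δ =
  subst (δ ⊑⟨ _ ⟩_) (++-assoc δ [ c ] (replicate m c)) (⊑-trans (step δ) (⊑-copies step m (δ ++ [ c ])))

⊑-ω^ : ∀ y c δ → δ ⊑⟨ y ⟩ δ ++ [ c ]
⊑-ω^ y c = Ind.append c [] (λ δ → ⊑-succ ⊑-refl)
  where
    module Ind = ExpInduction (λ c → ∀ δ → δ ⊑⟨ y ⟩ δ ++ [ c ])
      (λ c ih δ → ⊑-lim (fs-succ δ c) (⊑-copies ih (suc y) δ))
      (λ c q ih δ → ⊑-lim (fs-lim δ (fse c q)) (ih (suc y) δ))

⊑-exponent : ∀ y c s δ → δ ++ [ c ] ⊑⟨ y ⟩ δ ++ [ c ++ s ]
⊑-exponent y c s = Ind.append s c (λ δ → ⊑-refl)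
  where
    module Ind = ExpInduction (λ c′ → ∀ δ → δ ++ [ c ] ⊑⟨ y ⟩ δ ++ [ c′ ])
      (λ c′ ih δ → ⊑-lim (fs-succ δ c′)
        (⊑-trans (ih δ) (subst (δ ++ [ c′ ] ⊑⟨ y ⟩_) (++-assoc δ [ c′ ] (replicate y c′))
                                (⊑-copies (⊑-ω^ y c′) y (δ ++ [ c′ ])))))
      (λ c′ q ih δ → ⊑-lim (fs-lim δ (fse c′ q)) (ih (suc y) δ))

snoc≢[] : ∀ {X : Set} (g : List X) {x} → g ++ [ x ] ≡ [] → ⊥
snoc≢[] g eq with ++-conicalʳ g _ eq
... | ()

fs-source≢[] : ∀ {y a a′} → FS y a a′ → a ≡ [] → ⊥
fs-source≢[] (fs-succ g _) = snoc≢[] g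
fs-source≢[] (fs-lim g _)  = snoc≢[] g

fs-source≢succ : ∀ {y a a′ δ} → FS y a a′ → a ≡ δ ++ [ [] ] → ⊥
fs-source≢succ (fs-succ g b)        eq = snoc≢[] b (proj₂ (∷ʳ-injective g _ eq))
fs-source≢succ (fs-lim g (fse c q)) eq = snoc≢[] c (proj₂ (∷ʳ-injective g _ eq))

replicate-+ : ∀ {X : Set} m n (b : X) → replicate (m + n) b ≡ replicate m b ++ replicate n b
replicate-+ zero    n b = refl
replicate-+ (suc m) n b = cong (b ∷_) (replicate-+ m n b)

more-copies : ∀ {X : Set} (g : List X) b {x y} → x ≤ y →
              (g ++ replicate (suc x) b) ++ replicate (y ∸ x) b ≡ g ++ replicate (suc y) b
more-copies g b {x} {y} x≤y = begin
  (g ++ replicate (suc x) b) ++ replicate (y ∸ x) b ≡⟨ ++-assoc g _ _ ⟩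
  g ++ replicate (suc x) b ++ replicate (y ∸ x) b   ≡⟨ cong (g ++_) (replicate-+ (suc x) (y ∸ x) b) ⟨
  g ++ replicate (suc x + (y ∸ x)) b                ≡⟨ cong (λ m → g ++ replicate (suc m) b) (m+[n∸m]≡n x≤y) ⟩
  g ++ replicate (suc y) b                          ∎
  where open ≡-Reasoning

data Aligned (x y : ℕ) : Ord → Ord → Set where
  aligned-succ : ∀ g b → Aligned x y (g ++ replicate (suc x) b) (g ++ replicate (suc y) b)
  aligned-lim  : ∀ g c q → Aligned x y (g ++ [ c ++ replicate (suc x) q ]) (g ++ [ c ++ replicate (suc y) q ])

fs-aligned : ∀ {x y a ax ay} → FS x a ax → FS y a ay → Aligned x y ax ay
fs-aligned fx fy = aligned fx fy refl
  where
    aligned : ∀ {x y a a′ ax ay} → FS x a ax → FS y a′ ay → a ≡ a′ → Aligned x y ax ay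
    aligned (fs-succ g b) (fs-succ g′ b′) eq with ∷ʳ-injective g g′ eq
    ... | refl , eq′ with ∷ʳ-injective b b′ eq′
    ...   | refl , _ = aligned-succ g b
    aligned (fs-succ g b) (fs-lim g′ (fse c q)) eq with ∷ʳ-injective g g′ eq
    ... | refl , eq′ = ⊥-elim (0≢1+n (proj₂ (∷ʳ-injective b c eq′)))
    aligned (fs-lim g (fse c q)) (fs-succ g′ b) eq with ∷ʳ-injective g g′ eq
    ... | refl , eq′ = ⊥-elim (0≢1+n (sym (proj₂ (∷ʳ-injective c b eq′))))
    aligned (fs-lim g (fse c q)) (fs-lim g′ (fse c′ q′)) eq with ∷ʳ-injective g g′ eq
    ... | refl , eq′ with ∷ʳ-injective c c′ eq′
    ...   | refl , refl = aligned-lim g c q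

fs-deterministic : ∀ {y a a₁ a₂} → FS y a a₁ → FS y a a₂ → a₁ ≡ a₂
fs-deterministic f₁ f₂ with fs-aligned f₁ f₂
... | aligned-succ _ _  = refl
... | aligned-lim _ _ _ = refl

fs-at-level : ∀ {x} y {a ax} → FS x a ax → ∃ λ ay → FS y a ay
fs-at-level y (fs-succ g b)        = _ , fs-succ g b
fs-at-level y (fs-lim g (fse c q)) = _ , fs-lim g (fse c q)

aligned-⊑ : ∀ {x y ax ay} → x ≤ y → Aligned x y ax ay → ax ⊑⟨ y ⟩ ay
aligned-⊑ {x} {y} x≤y (aligned-succ g b) =
  subst (g ++ replicate (suc x) b ⊑⟨ y ⟩_) (more-copies g b x≤y)
        (⊑-copies (⊑-ω^ y b) (y ∸ x) (g ++ replicate (suc x) b))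
aligned-⊑ {x} {y} x≤y (aligned-lim g c q) =
  subst (λ e → g ++ [ c ++ replicate (suc x) q ] ⊑⟨ y ⟩ g ++ [ e ]) (more-copies c q x≤y)
        (⊑-exponent y (c ++ replicate (suc x) q) (replicate (y ∸ x) q) g)

⊑-mono : ∀ {x y β γ} → x ≤ y → β ⊑⟨ x ⟩ γ → β ⊑⟨ y ⟩ γ
⊑-mono x≤y ⊑-refl      = ⊑-refl
⊑-mono x≤y (⊑-succ r)  = ⊑-succ (⊑-mono x≤y r)
⊑-mono {y = y} x≤y (⊑-lim fx r) with fs-at-level y fx
... | _ , fy = ⊑-lim fy (⊑-trans (⊑-mono x≤y r) (aligned-⊑ x≤y (fs-aligned fx fy)))

⊑-[]-inv : ∀ {y β} → β ⊑⟨ y ⟩ [] → β ≡ []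
⊑-[]-inv r = inv r refl
  where
    inv : ∀ {y β a} → β ⊑⟨ y ⟩ a → a ≡ [] → β ≡ []
    inv ⊑-refl                 eq = eq
    inv (⊑-succ {γ = γ} _)     eq = ⊥-elim (snoc≢[] γ eq)
    inv (⊑-lim fs _)           eq = ⊥-elim (fs-source≢[] fs eq)

⊑-succ-inv : ∀ {y β δ} → β ⊑⟨ y ⟩ δ ++ [ [] ] → β ≡ δ ++ [ [] ] ⊎ β ⊑⟨ y ⟩ δ
⊑-succ-inv r = inv r refl
  where
    inv : ∀ {y β a δ} → β ⊑⟨ y ⟩ a → a ≡ δ ++ [ [] ] → β ≡ a ⊎ β ⊑⟨ y ⟩ δ
    inv ⊑-refl             _  = inj₁ refl
    inv (⊑-succ {γ = γ} r) eq with ∷ʳ-injective γ _ eq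
    ... | refl , _ = inj₂ r
    inv (⊑-lim fs _)       eq = ⊥-elim (fs-source≢succ fs eq)

⊑-lim-inv : ∀ {y β γ γ[y]} → β ⊑⟨ y ⟩ γ → FS y γ γ[y] → β ≡ γ ⊎ β ⊑⟨ y ⟩ γ[y]
⊑-lim-inv ⊑-refl        _  = inj₁ refl
⊑-lim-inv (⊑-succ _)    fs = ⊥-elim (fs-source≢succ fs refl)
⊑-lim-inv (⊑-lim fs′ r) fs = inj₂ (subst (_ ⊑⟨ _ ⟩_) (fs-deterministic fs′ fs) r)

module _ {h : ℕ → ℕ} where

  Len-[]-inv : ∀ {x v} → Len h [] x v → v ≡ 0
  Len-[]-inv l = inv l refl
    where
      inv : ∀ {a x v} → Len h a x v → a ≡ [] → v ≡ 0
      inv (len-zero _)             _  = refl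
      inv (len-succ {γ = γ} _)     eq = ⊥-elim (snoc≢[] γ eq)
      inv (len-lim fs _)           eq = ⊥-elim (fs-source≢[] fs eq)

  Len-succ-inv : ∀ {δ x v} → Len h (δ ++ [ [] ]) x v → ∃ λ v₀ → v ≡ suc v₀ × Len h δ (h x) v₀
  Len-succ-inv l = inv l refl
    where
      inv : ∀ {a δ x v} → Len h a x v → a ≡ δ ++ [ [] ] → ∃ λ v₀ → v ≡ suc v₀ × Len h δ (h x) v₀
      inv (len-zero _)         eq = ⊥-elim (snoc≢[] _ (sym eq))
      inv (len-succ {γ = γ} l) eq with ∷ʳ-injective γ _ eq
      ... | refl , _ = _ , refl , l
      inv (len-lim fs _)       eq = ⊥-elim (fs-source≢succ fs eq)

  Len-lim-inv : ∀ {γ x y v γ[y]} → Len h γ x v → FS y γ γ[y] → ∃ λ γ[x] → FS x γ γ[x] × Len h γ[x] x v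
  Len-lim-inv (len-zero _)     fs = ⊥-elim (fs-source≢[] fs refl)
  Len-lim-inv (len-succ _)     fs = ⊥-elim (fs-source≢succ fs refl)
  Len-lim-inv (len-lim fs′ l)  _  = _ , fs′ , l

smooth-mono : ∀ {h} → Smooth h → ∀ {x y} → x ≤ y → h x ≤ h y
smooth-mono sm {x} {zero}  z≤n = ≤-refl
smooth-mono sm {x} {suc y} x≤y with m≤n⇒m<n∨m≡n x≤y
... | inj₂ refl     = ≤-refl
... | inj₁ (s≤s x≤y′) = ≤-trans (smooth-mono sm x≤y′) (<⇒≤ (proj₁ (sm y)))

smooth-inflationary : ∀ {h} → Smooth h → ∀ y → y ≤ h y
smooth-inflationary sm y = ≤-trans (n≤1+n y) (≤-pred (proj₂ (sm y)))

Reaches : ℕ → Ord → Ord → Set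
Reaches y β γ = β ⊑⟨ y ⟩ γ ⊎ (β <O γ × Slim y β)

-- By induction on the derivation of h_γ(y); successor steps
-- raise the level to h(y) ≥ y, limit steps use below-fundamental.
Len-mono : ∀ {h γ y v} → Smooth h → Len h γ y v → ∀ {β x v′} → x ≤ y → Len h β x v′ → Reaches y β γ → v′ ≤ v
Len-mono sm (len-zero y) _ lβ (inj₁ r) with ⊑-[]-inv r
... | refl = ≤-reflexive (Len-[]-inv lβ)
Len-mono sm (len-zero y) _ lβ (inj₂ (β<[] , _)) = ⊥-elim (xs≮[] β<[])
Len-mono sm (len-succ {x = y} l) x≤y lβ (inj₁ r) with ⊑-succ-inv r
... | inj₁ refl with Len-succ-inv lβ
...   | _ , refl , lδ = s≤s (Len-mono sm l (smooth-mono sm x≤y) lδ (inj₁ ⊑-refl))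
Len-mono sm (len-succ {x = y} l) x≤y lβ (inj₁ r) | inj₂ r′ =
  m≤n⇒m≤1+n (Len-mono sm l (≤-trans x≤y (smooth-inflationary sm y)) lβ (inj₁ (⊑-mono (smooth-inflationary sm y) r′)))
Len-mono {h} sm (len-succ {γ = δ} {x = y} l) x≤y lβ (inj₂ (lt , slim)) =
  m≤n⇒m≤1+n (Len-mono sm l (≤-trans x≤y (smooth-inflationary sm y)) lβ reaches-δ)
  where
    reaches-δ : Reaches (h y) _ δ
    reaches-δ with O.<ₗ-snoc-least (λ _ → xs≮[]) δ lt
    ... | inj₁ refl = inj₁ ⊑-refl
    ... | inj₂ lt′  = inj₂ (lt′ , Slim-mono (smooth-inflationary sm y) slim)
Len-mono sm (len-lim fs l) x≤y lβ (inj₁ r) with ⊑-lim-inv r fs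
... | inj₁ refl with Len-lim-inv lβ fs
...   | _ , fx , lx = Len-mono sm l x≤y lx (inj₁ (aligned-⊑ x≤y (fs-aligned fx fs)))
Len-mono sm (len-lim fs l) x≤y lβ (inj₁ r) | inj₂ r′ = Len-mono sm l x≤y lβ (inj₁ r′)
Len-mono sm (len-lim fs l) x≤y lβ (inj₂ (lt , slim)) = Len-mono sm l x≤y lβ (inj₂ (below-fundamental lt slim fs , slim))

sum-tabulate-mono : ∀ {n} (f g : Fin n → ℕ) → (∀ j → f j ≤ g j) → sum (tabulate f) ≤ sum (tabulate g)
sum-tabulate-mono {zero}  f g f≤g = z≤n
sum-tabulate-mono {suc n} f g f≤g =
  +-mono-≤ (f≤g zero) (sum-tabulate-mono (λ j → f (suc j)) (λ j → g (suc j)) (λ j → f≤g (suc j)))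

sum-tabulate-* : ∀ {n} m (g : Fin n → ℕ) → sum (tabulate (λ j → m * g j)) ≡ m * sum (tabulate g)
sum-tabulate-* {zero}  m g = sym (*-zeroʳ m)
sum-tabulate-* {suc n} m g =
  trans (cong (m * g zero +_) (sum-tabulate-* m (λ j → g (suc j)))) (sym (*-distribˡ-+ m (g zero) _))

sum-tabulate-zero : ∀ {n} (f : Fin n → ℕ) → (∀ j → f j ≡ 0) → sum (tabulate f) ≡ 0
sum-tabulate-zero {zero}  f f≡0 = refl
sum-tabulate-zero {suc n} f f≡0 = cong₂ _+_ (f≡0 zero) (sum-tabulate-zero (λ j → f (suc j)) (λ j → f≡0 (suc j)))

⨁-All : ∀ {P : Exp → Set} Ls → All (All P) Ls → All P (⨁ Ls)
⨁-All      []       []         = []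
⨁-All {P} (L ∷ Ls) (pL ∷ pLs) = subst (All P) (sym (⊕-merge L (⨁ Ls))) (O.merge-All L (⨁ Ls) pL (⨁-All Ls pLs))

⨁-sorted : ∀ Ls → All O.Sorted Ls → O.Sorted (⨁ Ls)
⨁-sorted []       []         = []
⨁-sorted (L ∷ Ls) (sL ∷ sLs) = subst O.Sorted (sym (⊕-merge L (⨁ Ls))) (O.merge-sorted L (⨁ Ls) sL (⨁-sorted Ls sLs))

⨁-count : ∀ e Ls → O.count e (⨁ Ls) ≡ sum (map (O.count e) Ls)
⨁-count e []       = refl
⨁-count e (L ∷ Ls) =
  trans (cong (O.count e) (⊕-merge L (⨁ Ls))) (trans (O.merge-count e L (⨁ Ls)) (cong (O.count e L +_) (⨁-count e Ls)))

⨁-replicate : ∀ m e → ⨁ (replicate m [ e ]) ≡ replicate m e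
⨁-replicate zero          e = refl
⨁-replicate (suc zero)    e = refl
⨁-replicate (suc (suc m)) e =
  trans (cong ([ e ] ⊕_) (⨁-replicate (suc m) e)) (if-true (e ≤Eᵇ e) (≤Eᵇ-refl e))

-- D_n(ω^{ω^p}) = ω^{lowered (n-1) p}·(n-1): lowered m p is the exponent
-- ω^{p-1}·m (empty for p = 0).
lowered : ℕ → ℕ → Exp
lowered m zero    = []
lowered m (suc q) = replicate m q

Dbase-lowered : ∀ n p → Dbase n p ≡ replicate (n ∸ 1) (lowered (n ∸ 1) p)
Dbase-lowered n zero    = refl
Dbase-lowered n (suc p) = refl

lowered-below : ∀ m p → All (_< p) (lowered m p)
lowered-below m zero    = []
lowered-below m (suc q) = replicate⁺ m ≤-refl

lowered-sorted : ∀ m p → E.Sorted (lowered m p)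
lowered-sorted m zero    = []
lowered-sorted m (suc q) = E.replicate-sorted m q

lowered-count : ∀ m p q → E.count q (lowered m p) ≤ m
lowered-count m zero    q = z≤n
lowered-count m (suc p) q = E.count-replicate-≤ q m p

-- The exponent of the j-th summand of D_n(ω^β): β with its j-th term ω^{β_j}
-- replaced by ω^{lowered m β_j}.
Dexp : ℕ → (β : Exp) → Fin (length β) → Exp
Dexp m β j = E.merge (lowered m (lookup β j)) (removeAt β j)

D-summands : ∀ n β → D n β ≡ ⨁ (tabulate (λ j → replicate (n ∸ 1) (Dexp (n ∸ 1) β j)))
D-summands n β = trans (cong ⨁ (map-tabulate (λ j → j) summand)) (cong ⨁ (tabulate-cong summand-eq))
  where
    m : ℕ
    m = n ∸ 1
    summand : Fin (length β) → Ord
    summand j = Dbase n (lookup β j) ⊗ ω^ (removeAt β j)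
    summand-eq : ∀ j → summand j ≡ replicate m (Dexp m β j)
    summand-eq j = begin
      Dbase n p ⊗ ω^ r                      ≡⟨ cong (_⊗ ω^ r) (Dbase-lowered n p) ⟩
      replicate m (lowered m p) ⊗ ω^ r      ≡⟨ cong ⨁ (map-replicate _ m (lowered m p)) ⟩
      ⨁ (replicate m [ lowered m p ⊕E r ]) ≡⟨ ⨁-replicate m _ ⟩
      replicate m (lowered m p ⊕E r)        ≡⟨ cong (replicate m) (⊕E-merge (lowered m p) r) ⟩
      replicate m (Dexp m β j)              ∎
      where
        open ≡-Reasoning
        p : ℕ
        p = lookup β j
        r : Exp
        r = removeAt β j

D-All : ∀ {P : Exp → Set} n β → (∀ j → P (Dexp (n ∸ 1) β j)) → All P (D n β)
D-All {P} n β p = subst (All P) (sym (D-summands n β))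
  (⨁-All _ (tabulate⁺ {f = λ j → replicate (n ∸ 1) (Dexp (n ∸ 1) β j)} (λ j → replicate⁺ (n ∸ 1) (p j))))

D-sorted : ∀ n β → O.Sorted (D n β)
D-sorted n β = subst O.Sorted (sym (D-summands n β))
  (⨁-sorted _ (tabulate⁺ {f = λ j → replicate (n ∸ 1) (Dexp (n ∸ 1) β j)} (λ j → O.replicate-sorted (n ∸ 1) _)))

D-count : ∀ n β e → O.count e (D n β) ≡ sum (tabulate (λ j → if e ≡Eᵇ Dexp (n ∸ 1) β j then n ∸ 1 else 0))
D-count n β e = begin
  O.count e (D n β)                         ≡⟨ cong (O.count e) (D-summands n β) ⟩
  O.count e (⨁ (tabulate summand))         ≡⟨ ⨁-count e (tabulate summand) ⟩
  sum (map (O.count e) (tabulate summand))  ≡⟨ cong sum (map-tabulate summand (O.count e)) ⟩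
  sum (tabulate (λ j → O.count e (summand j))) ≡⟨ cong sum (tabulate-cong (λ j → O.count-replicate e (n ∸ 1) (Dexp (n ∸ 1) β j))) ⟩
  sum (tabulate (λ j → if e ≡Eᵇ Dexp (n ∸ 1) β j then n ∸ 1 else 0)) ∎
  where
    open ≡-Reasoning
    summand : Fin (length β) → Ord
    summand j = replicate (n ∸ 1) (Dexp (n ∸ 1) β j)

Dexp-below : ∀ m β j → DescExp β → Dexp m β j <E β
Dexp-below m β j desc = E.merge-below β j (lowered m (lookup β j)) (desc-sorted desc) (lowered-below m (lookup β j))

Dexp-desc : ∀ m β j → DescExp β → DescExp (Dexp m β j)
Dexp-desc m β j desc = sorted-desc
  (E.merge-sorted _ _ (lowered-sorted m (lookup β j)) (E.removeAt-sorted β j (desc-sorted desc)))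

Dexp-count : ∀ m β j q → E.count q (Dexp m β j) ≡ E.count q (lowered m (lookup β j)) + E.count q (removeAt β j)
Dexp-count m β j q = E.merge-count q (lowered m (lookup β j)) (removeAt β j)

Dexp-count-above : ∀ m β j {r} → lookup β j ≤ r → E.count r (Dexp m β j) ≡ E.count r (removeAt β j)
Dexp-count-above m β j β_j≤r = trans (Dexp-count m β j _)
  (cong (_+ _) (E.count-below _ (All.map (λ q<β_j → <-≤-trans q<β_j β_j≤r) (lowered-below m (lookup β j)))))

-- Positions carrying different values give different summand exponents:
-- r = β_j′ > β_j occurs in Dexp j as often as in β, but once less in Dexp j′.
Dexp-separates : ∀ m β j j′ → lookup β j < lookup β j′ → Dexp m β j ≡ Dexp m β j′ → ⊥
Dexp-separates m β j j′ β_j<r same = 1+n≢n (begin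
  suc (E.count r (removeAt β j′)) ≡⟨ E.removeAt-count-same β j′ ⟨
  E.count r β                     ≡⟨ E.removeAt-count-other r β j (λ r≡β_j → <-irrefl (sym r≡β_j) β_j<r) ⟨
  E.count r (removeAt β j)        ≡⟨ Dexp-count-above m β j (<⇒≤ β_j<r) ⟨
  E.count r (Dexp m β j)          ≡⟨ cong (E.count r) same ⟩
  E.count r (Dexp m β j′)         ≡⟨ Dexp-count-above m β j′ ≤-refl ⟩
  E.count r (removeAt β j′)       ∎)
  where
    open ≡-Reasoning
    r : ℕ
    r = lookup β j′

Dexp-injective : ∀ m β j j′ → Dexp m β j ≡ Dexp m β j′ → lookup β j ≡ lookup β j′
Dexp-injective m β j j′ same with <-cmp (lookup β j) (lookup β j′)
... | tri< lt _ _ = ⊥-elim (Dexp-separates m β j j′ lt same)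
... | tri≈ _ eq _ = eq
... | tri> _ _ gt = ⊥-elim (Dexp-separates m β j′ j gt (sym same))

-- If no natural occurs more than k times in β, no exponent occurs more than
-- (n-1)·k times in D_n(ω^β): the positions j with Dexp j = e all carry
-- the same value β_j₀.
D-count-bound : ∀ n β k → (∀ q → E.count q β ≤ k) → ∀ e → O.count e (D n β) ≤ (n ∸ 1) * k
D-count-bound n β k bound e with any? (λ j → T? (e ≡Eᵇ Dexp (n ∸ 1) β j))
... | no none = ≤-trans (≤-reflexive (trans (D-count n β e) (sum-tabulate-zero _ (λ j → if-false _ (λ t → none (j , t)))))) z≤n
... | yes (j₀ , e≡j₀) = begin
  O.count e (D n β)                                       ≡⟨ D-count n β e ⟩
  sum (tabulate (λ j → if e ≡Eᵇ Dexp m β j then m else 0)) ≤⟨ sum-tabulate-mono _ _ pointwise ⟩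
  sum (tabulate (λ j → m * same-value j))                  ≡⟨ sum-tabulate-* m same-value ⟩
  m * sum (tabulate same-value)                            ≡⟨ cong (m *_) (E.count-as-sum p₀ β) ⟨
  m * E.count p₀ β                                         ≤⟨ *-monoʳ-≤ m (bound p₀) ⟩
  m * k                                                    ∎
  where
    open Data.Nat.Properties.≤-Reasoning
    m : ℕ
    m = n ∸ 1
    p₀ : ℕ
    p₀ = lookup β j₀
    same-value : Fin (length β) → ℕ
    same-value j = if p₀ ≡ᵇ lookup β j then 1 else 0
    pointwise : ∀ j → (if e ≡Eᵇ Dexp m β j then m else 0) ≤ m * same-value j
    pointwise j with T? (e ≡Eᵇ Dexp m β j)
    ... | no ¬e≡j = ≤-trans (≤-reflexive (if-false _ ¬e≡j)) z≤n
    ... | yes e≡j = ≤-trans (≤-reflexive (if-true _ e≡j))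
      (≤-reflexive (sym (trans (cong (m *_) (if-true _ (≡⇒≡ᵇ _ _ p₀≡p))) (*-identityʳ m))))
      where
        p₀≡p : p₀ ≡ lookup β j
        p₀≡p = Dexp-injective m β j₀ j (trans (sym (≡Eᵇ-sound e≡j₀)) (≡Eᵇ-sound e≡j))

lean-exp-count : ∀ {k β} → LeanExp k β → ∀ q → E.count q β ≤ k
lean-exp-count {k} {β} lean = E.count-bound β (λ q∈β → subst (_≤ k) (countℕ-count _ β) (proj₂ (All.lookup lean q∈β)))

lean-count : ∀ {k α} → Lean k α → ∀ e → O.count e α ≤ k
lean-count {k} {α} lean = O.count-bound α (λ e∈α → subst (_≤ k) (countE-count _ α) (proj₂ (All.lookup lean e∈α)))

-- Every α′ ∈ ∂ₙ α lies below α: it replaces a term ω^β of α by terms ω^{Dexp j} with Dexp j < β.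
∂-below : ∀ n α α′ → IsCNF α → α′ ∈∂[ n ] α → α′ <O α
∂-below n α _ (desc , sorted) (i , refl) = subst (_<O α) (sym (⊕-merge (D n β) (removeAt α i)))
  (O.merge-below α i (D n β) sorted (D-All n β (λ j → Dexp-below (n ∸ 1) β j (All.lookup desc (∈-lookup i)))))
  where
    β : Exp
    β = lookup α i

-- Every α′ ∈ ∂ₙ α of a k-lean α is kn-slim: exponents of α′ occur at most
-- (n-1)·k + k times, and naturals inside them at most (n-1) + k times.
∂-slim : ∀ k n α α′ → 0 < k → 0 < n → IsCNF α → Lean k α → α′ ∈∂[ n ] α → Slim (k * n) α′
∂-slim (suc k′) (suc n′) α _ _ _ (desc , sorted) lean (i , refl) =
  subst (Slim (k * n)) (sym (⊕-merge X R)) ((all-desc , all-sorted) , counts , exp-counts)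
  where
    open Data.Nat.Properties.≤-Reasoning
    k n : ℕ
    k = suc k′
    n = suc n′
    β : Exp
    β = lookup α i
    X R : Ord
    X = D n β
    R = removeAt α i
    desc-β : DescExp β
    desc-β = All.lookup desc (∈-lookup i)
    β-counts : ∀ q → E.count q β ≤ k
    β-counts = lean-exp-count (proj₁ (All.lookup lean (∈-lookup i)))
    all-desc : All DescExp (O.merge X R)
    all-desc = O.merge-All X R (D-All n β (λ j → Dexp-desc n′ β j desc-β)) (O.removeAt-All α i desc)
    all-sorted : O.Sorted (O.merge X R)
    all-sorted = O.merge-sorted X R (D-sorted n β) (O.removeAt-sorted α i sorted)
    counts : ∀ e → countE e (O.merge X R) ≤ k * n
    counts e = begin
      countE e (O.merge X R)     ≡⟨ countE-count e (O.merge X R) ⟩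
      O.count e (O.merge X R)    ≡⟨ O.merge-count e X R ⟩
      O.count e X + O.count e R  ≤⟨ +-mono-≤ (D-count-bound n β k β-counts e)
                                             (≤-trans (O.removeAt-count-≤ e α i) (lean-count lean e)) ⟩
      n′ * k + k                 ≡⟨ +-comm (n′ * k) k ⟩
      k + n′ * k                 ≡⟨ cong (k +_) (*-comm n′ k) ⟩
      k + k * n′                 ≡⟨ *-suc k n′ ⟨
      k * n                      ∎
    Dexp-counts : ∀ j q → countℕ q (Dexp n′ β j) ≤ k * n
    Dexp-counts j q = begin
      countℕ q (Dexp n′ β j)                                    ≡⟨ countℕ-count q (Dexp n′ β j) ⟩
      E.count q (Dexp n′ β j)                                   ≡⟨ Dexp-count n′ β j q ⟩
      E.count q (lowered n′ (lookup β j)) + E.count q (removeAt β j)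
        ≤⟨ +-mono-≤ (lowered-count n′ (lookup β j) q) (≤-trans (E.removeAt-count-≤ q β j) (β-counts q)) ⟩
      n′ + k                                                    ≡⟨ +-comm n′ k ⟩
      k + n′                                                    ≤⟨ +-mono-≤ (≤-refl {k}) (m≤n*m n′ k) ⟩
      k + k * n′                                                ≡⟨ *-suc k n′ ⟨
      k * n                                                     ∎
    exp-counts : All (λ e → ∀ q → countℕ q e ≤ k * n) (O.merge X R)
    exp-counts = O.merge-All X R (D-All n β Dexp-counts)
      (O.removeAt-All α i (All.map (λ {e} (lean-e , _) q →
        ≤-trans (≤-reflexive (countℕ-count q e)) (≤-trans (lean-exp-count lean-e q) (m≤m*n k n))) lean))

corollary1 : (k n : ℕ) → 0 < k → 0 < n → (h : ℕ → ℕ) → Smooth h →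
    (α α' : Ord) → IsCNF α → Lean k α → α' ∈∂[ n ] α →
    (x : ℕ) → k * n ≤ x →
    ∀ {p v v'} → Pred (k * n) α p → Len h α' x v' → Len h p x v → v' ≤ v
corollary1 k n 0<k 0<n h smooth α α′ cnf lean α′∈∂α x kn≤x {p} pred len-α′ len-p =
  Len-mono smooth len-p ≤-refl len-α′ reaches
  where
    slim : Slim (k * n) α′
    slim = ∂-slim k n α α′ 0<k 0<n cnf lean α′∈∂α
    -- α′ < α and α′ is kn-slim, so α′ ≤ P_{kn}(α); being x-slim it reaches P_{kn}(α).
    reaches : Reaches x α′ p
    reaches with below-pred pred (∂-below n α α′ cnf α′∈∂α) slim
    ... | inj₁ refl = inj₁ ⊑-refl
    ... | inj₂ α′<p = inj₂ (α′<p , Slim-mono kn≤x slim)
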